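{- Let $\mathcal{M}=(E,r)$ be a matroid and let $D\subseteq E$ be a $k$-fold circuit of $\mathcal{M}$. Let $\{B_1,B_2,\ldots,B_\ell\}$ be the set of all $(k-1)$-fold circuits of $\mathcal{M}$ contained in $D$, and put $A_i=D\setminus B_i$ for $1\leq i\leq \ell$. Then $\{A_1,\dots,A_\ell\}$ is a partition of $D$ and $\ell\geq k$.
   Context: Matroids have finite ground sets. A cyclic set of a matroid $\mathcal{M}=(E,r)$ is a union of circuits, equivalently a set $D\subseteq E$ with $r(D-e)=r(D)$ for all $e\in D$. For a nonnegative integer $k$, a $k$-fold circuit of $\mathcal{M}$ is a cyclic set $D\subseteq E$ with $r(D)=|D|-k$. -}

module Defs where

open import Data.Nat using (ℕ; _+_; _≤_)
open import Data.Fin using (Fin)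
open import Data.Fin.Subset using (Subset; _∈_; _⊆_; _∪_; _∩_; _-_; ∣_∣)
open import Relation.Binary.PropositionalEquality using (_≡_)

record Matroid (n : ℕ) : Set where
  field
    r         : Subset n → ℕ
    r-bounded : ∀ X → r X ≤ ∣ X ∣
    r-mono    : ∀ X Y → X ⊆ Y → r X ≤ r Y
    r-submod  : ∀ X Y → r (X ∪ Y) + r (X ∩ Y) ≤ r X + r Y

open Matroid public

Cyclic : ∀ {n} → Matroid n → Subset n → Set
Cyclic M D = ∀ e → e ∈ D → r M (D - e) ≡ r M D

FoldCircuit : ∀ {n} → Matroid n → ℕ → Subset n → Set
FoldCircuit M k D = Cyclic M D × (r M D + k ≡ ∣ D ∣)
  where open import Data.Product using (_×_)

module Submission where

-- Work with the nullity ν X = |X| − r X, which is monotone and supermodular.  Deleting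
-- an element of a cyclic set lowers ν by one, deleting a coloop leaves it unchanged.
-- So for e ∈ D the set D − e has nullity k, and stripping its coloops one at a time
-- leaves a k-fold circuit avoiding e: the sets D − B cover D.  Two different k-fold
-- circuits avoiding the same e would have a cyclic union strictly bigger than either,
-- hence of nullity > k, inside D − e of nullity k: the sets D − B are disjoint.
-- Finally, supermodularity gives ν (B ∩ X) ≥ ν X − 1 for X ⊆ D, so intersecting D
-- with all ℓ circuits B drops the nullity k + 1 by at most ℓ; as the D − B cover D,
-- the result is empty and has nullity 0.

open import Defs
open import Data.Fin using (Fin)
open import Data.Fin.Properties using (any?)
open import Data.Fin.Subset
  using (Subset; _∈_; _∉_; _⊆_; _─_; _-_; _∪_; _∩_; ⁅_⁆; ∣_∣; Nonempty; Empty; inside; outside)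
open import Data.Fin.Subset.Properties
open import Data.List using (List; []; _∷_; foldr; length)
open import Data.List.Membership.Propositional using () renaming (_∈_ to _∈ₗ_)
open import Data.List.Relation.Unary.Any using (here; there)
open import Data.List.Relation.Unary.Unique.Propositional using (Unique)
open import Data.Nat using (ℕ; suc; _+_; _∸_; _≤_; _<_; _≟_)
open import Data.Nat.Induction using (<-wellFounded)
open import Data.Nat.Properties
open import Algebra.Properties.CommutativeSemigroup +-commutativeSemigroup using (interchange)
open import Data.Product using (_×_; ∃; Σ-syntax; _,_; proj₁; proj₂)
open import Data.Sum using (inj₁; inj₂; [_,_]′)
open import Data.Vec using ([]; _∷_; here; there)
open import Function using (_∘_; id)
open import Function.Bundles using (_⇔_; Equivalence)
open import Induction.WellFounded using (Acc; acc)
open import Relation.Binary.PropositionalEquality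
  using (_≡_; _≢_; refl; sym; trans; cong; cong₂; subst; module ≡-Reasoning)
open import Relation.Nullary using (yes; no; contradiction)
open import Relation.Nullary.Decidable using (_×-dec_; ¬?; decidable-stable)

m+x≡n+y∧m≤n⇒y≤x : ∀ {m n x y} → m + x ≡ n + y → m ≤ n → y ≤ x
m+x≡n+y∧m≤n⇒y≤x {m} {n} {x} {y} eq m≤n = +-cancelˡ-≤ n y x (begin
  n + y ≡⟨ sym eq ⟩
  m + x ≤⟨ +-monoˡ-≤ x m≤n ⟩
  n + x ∎)
  where open ≤-Reasoning

x∈p─q⇒x∉q : ∀ {n} {x : Fin n} (p q : Subset n) → x ∈ p ─ q → x ∉ q
x∈p─q⇒x∉q (_ ∷ p) (outside ∷ q) here       ()
x∈p─q⇒x∉q (_ ∷ p) (_       ∷ q) (there x∈) (there x∈q) = x∈p─q⇒x∉q p q x∈ x∈q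

p⊆p─q∪q : ∀ {n} (p q : Subset n) → p ⊆ (p ─ q) ∪ q
p⊆p─q∪q p q {x} x∈p with x ∈? q
... | yes x∈q = q⊆p∪q (p ─ q) q x∈q
... | no  x∉q = p⊆p∪q q (x∈p∧x∉q⇒x∈p─q x∈p x∉q)

Empty[p─q]⇒p⊆q : ∀ {n} (p q : Subset n) → Empty (p ─ q) → p ⊆ q
Empty[p─q]⇒p⊆q p q empty {x} x∈p with x ∈? q
... | yes x∈q = x∈q
... | no  x∉q = contradiction (x , x∈p∧x∉q⇒x∈p─q x∈p x∉q) empty

p⊆q∧x∉p⇒p⊆q-x : ∀ {n} {p q : Subset n} {x} → p ⊆ q → x ∉ p → p ⊆ q - x
p⊆q∧x∉p⇒p⊆q-x p⊆q x∉p y∈p = x∈p∧x≢y⇒x∈p-y (p⊆q y∈p) λ { refl → x∉p y∈p }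

∣p∪q∣+∣p∩q∣≡∣p∣+∣q∣ : ∀ {n} (p q : Subset n) → ∣ p ∪ q ∣ + ∣ p ∩ q ∣ ≡ ∣ p ∣ + ∣ q ∣
∣p∪q∣+∣p∩q∣≡∣p∣+∣q∣ []            []            = refl
∣p∪q∣+∣p∩q∣≡∣p∣+∣q∣ (outside ∷ p) (outside ∷ q) = ∣p∪q∣+∣p∩q∣≡∣p∣+∣q∣ p q
∣p∪q∣+∣p∩q∣≡∣p∣+∣q∣ (inside  ∷ p) (outside ∷ q) = cong suc (∣p∪q∣+∣p∩q∣≡∣p∣+∣q∣ p q)
∣p∪q∣+∣p∩q∣≡∣p∣+∣q∣ (outside ∷ p) (inside  ∷ q) =
  trans (cong suc (∣p∪q∣+∣p∩q∣≡∣p∣+∣q∣ p q)) (sym (+-suc ∣ p ∣ ∣ q ∣))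
∣p∪q∣+∣p∩q∣≡∣p∣+∣q∣ (inside  ∷ p) (inside  ∷ q) = cong suc (begin
  ∣ p ∪ q ∣ + suc ∣ p ∩ q ∣   ≡⟨ +-suc ∣ p ∪ q ∣ ∣ p ∩ q ∣ ⟩
  suc (∣ p ∪ q ∣ + ∣ p ∩ q ∣) ≡⟨ cong suc (∣p∪q∣+∣p∩q∣≡∣p∣+∣q∣ p q) ⟩
  suc (∣ p ∣ + ∣ q ∣)         ≡⟨ +-suc ∣ p ∣ ∣ q ∣ ⟨
  ∣ p ∣ + suc ∣ q ∣           ∎)
  where open ≡-Reasoning

∣p─q∣+∣q∣≡∣p∣ : ∀ {n} (p q : Subset n) → q ⊆ p → ∣ p ─ q ∣ + ∣ q ∣ ≡ ∣ p ∣
∣p─q∣+∣q∣≡∣p∣ []            []            _   = refl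
∣p─q∣+∣q∣≡∣p∣ (outside ∷ p) (outside ∷ q) q⊆p = ∣p─q∣+∣q∣≡∣p∣ p q (drop-∷-⊆ q⊆p)
∣p─q∣+∣q∣≡∣p∣ (inside  ∷ p) (outside ∷ q) q⊆p = cong suc (∣p─q∣+∣q∣≡∣p∣ p q (drop-∷-⊆ q⊆p))
∣p─q∣+∣q∣≡∣p∣ (outside ∷ p) (inside  ∷ q) q⊆p = contradiction (q⊆p here) λ ()
∣p─q∣+∣q∣≡∣p∣ (inside  ∷ p) (inside  ∷ q) q⊆p =
  trans (+-suc ∣ p ─ q ∣ ∣ q ∣) (cong suc (∣p─q∣+∣q∣≡∣p∣ p q (drop-∷-⊆ q⊆p)))

x∈p⇒suc∣p-x∣≡∣p∣ : ∀ {n} {p : Subset n} {x} → x ∈ p → suc ∣ p - x ∣ ≡ ∣ p ∣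
x∈p⇒suc∣p-x∣≡∣p∣ {p = p} {x} x∈p = begin
  suc ∣ p - x ∣         ≡⟨ +-comm 1 ∣ p - x ∣ ⟩
  ∣ p - x ∣ + 1         ≡⟨ cong (∣ p - x ∣ +_) (∣⁅x⁆∣≡1 x) ⟨
  ∣ p - x ∣ + ∣ ⁅ x ⁆ ∣ ≡⟨ ∣p─q∣+∣q∣≡∣p∣ p ⁅ x ⁆ ⁅x⁆⊆p ⟩
  ∣ p ∣                 ∎
  where
  open ≡-Reasoning
  ⁅x⁆⊆p : ⁅ x ⁆ ⊆ p
  ⁅x⁆⊆p y∈⁅x⁆ = subst (_∈ p) (sym (x∈⁅y⁆⇒x≡y x y∈⁅x⁆)) x∈p

module Nullity {n} (M : Matroid n) where

  ν : Subset n → ℕ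
  ν X = ∣ X ∣ ∸ r M X

  r+ν≡∣∣ : ∀ X → r M X + ν X ≡ ∣ X ∣
  r+ν≡∣∣ X = m+[n∸m]≡n (r-bounded M X)

  r+m≡∣∣⇒ν≡m : ∀ {X m} → r M X + m ≡ ∣ X ∣ → ν X ≡ m
  r+m≡∣∣⇒ν≡m {X} eq = +-cancelˡ-≡ (r M X) _ _ (trans (r+ν≡∣∣ X) (sym eq))

  ν≤∣∣ : ∀ X → ν X ≤ ∣ X ∣
  ν≤∣∣ X = m∸n≤m ∣ X ∣ (r M X)

  r-subadditive : ∀ {X Y Z} → Z ⊆ X ∪ Y → r M Z ≤ r M X + r M Y
  r-subadditive {X} {Y} {Z} Z⊆X∪Y = begin
    r M Z                           ≤⟨ r-mono M Z (X ∪ Y) Z⊆X∪Y ⟩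
    r M (X ∪ Y)                     ≤⟨ m≤m+n (r M (X ∪ Y)) (r M (X ∩ Y)) ⟩
    r M (X ∪ Y) + r M (X ∩ Y)       ≤⟨ r-submod M X Y ⟩
    r M X + r M Y                   ∎
    where open ≤-Reasoning

  ν-supermodular : ∀ X Y → ν X + ν Y ≤ ν (X ∪ Y) + ν (X ∩ Y)
  ν-supermodular X Y = m+x≡n+y∧m≤n⇒y≤x (begin
    (r M (X ∪ Y) + r M (X ∩ Y)) + (ν (X ∪ Y) + ν (X ∩ Y))
      ≡⟨ interchange (r M (X ∪ Y)) (r M (X ∩ Y)) (ν (X ∪ Y)) (ν (X ∩ Y)) ⟩
    (r M (X ∪ Y) + ν (X ∪ Y)) + (r M (X ∩ Y) + ν (X ∩ Y))
      ≡⟨ cong₂ _+_ (r+ν≡∣∣ (X ∪ Y)) (r+ν≡∣∣ (X ∩ Y)) ⟩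
    ∣ X ∪ Y ∣ + ∣ X ∩ Y ∣
      ≡⟨ ∣p∪q∣+∣p∩q∣≡∣p∣+∣q∣ X Y ⟩
    ∣ X ∣ + ∣ Y ∣
      ≡⟨ cong₂ _+_ (r+ν≡∣∣ X) (r+ν≡∣∣ Y) ⟨
    (r M X + ν X) + (r M Y + ν Y)
      ≡⟨ interchange (r M X) (ν X) (r M Y) (ν Y) ⟩
    (r M X + r M Y) + (ν X + ν Y) ∎) (r-submod M X Y)
    where open ≡-Reasoning

  ν-mono : ∀ {X Y} → X ⊆ Y → ν X ≤ ν Y
  ν-mono {X} {Y} X⊆Y = m+x≡n+y∧m≤n⇒y≤x count rank-growth
    where
    count : r M Y + ν Y ≡ ∣ Y ─ X ∣ + r M X + ν X
    count = begin
      r M Y + ν Y               ≡⟨ r+ν≡∣∣ Y ⟩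
      ∣ Y ∣                     ≡⟨ ∣p─q∣+∣q∣≡∣p∣ Y X X⊆Y ⟨
      ∣ Y ─ X ∣ + ∣ X ∣         ≡⟨ cong (∣ Y ─ X ∣ +_) (r+ν≡∣∣ X) ⟨
      ∣ Y ─ X ∣ + (r M X + ν X) ≡⟨ +-assoc ∣ Y ─ X ∣ (r M X) (ν X) ⟨
      ∣ Y ─ X ∣ + r M X + ν X   ∎
      where open ≡-Reasoning
    rank-growth : r M Y ≤ ∣ Y ─ X ∣ + r M X
    rank-growth = ≤-trans (r-subadditive (p⊆p─q∪q Y X)) (+-monoˡ-≤ (r M X) (r-bounded M (Y ─ X)))

  r≤1+r[X-f] : ∀ X f → r M X ≤ suc (r M (X - f))
  r≤1+r[X-f] X f = begin
    r M X                   ≤⟨ r-subadditive (p⊆p─q∪q X ⁅ f ⁆) ⟩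
    r M (X - f) + r M ⁅ f ⁆ ≤⟨ +-monoʳ-≤ (r M (X - f)) (r-bounded M ⁅ f ⁆) ⟩
    r M (X - f) + ∣ ⁅ f ⁆ ∣ ≡⟨ cong (r M (X - f) +_) (∣⁅x⁆∣≡1 f) ⟩
    r M (X - f) + 1         ≡⟨ +-comm (r M (X - f)) 1 ⟩
    suc (r M (X - f))       ∎
    where open ≤-Reasoning

  ν[X-f]≡ν[X] : ∀ {X f} → f ∈ X → r M (X - f) ≢ r M X → ν (X - f) ≡ ν X
  ν[X-f]≡ν[X] {X} {f} f∈X r≢ = sym (r+m≡∣∣⇒ν≡m (begin
    r M X + ν (X - f)             ≡⟨ cong (_+ ν (X - f)) rank-drop ⟩
    suc (r M (X - f) + ν (X - f)) ≡⟨ cong suc (r+ν≡∣∣ (X - f)) ⟩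
    suc ∣ X - f ∣                 ≡⟨ x∈p⇒suc∣p-x∣≡∣p∣ f∈X ⟩
    ∣ X ∣                         ∎))
    where
    open ≡-Reasoning
    rank-drop : r M X ≡ suc (r M (X - f))
    rank-drop = ≤-antisym (r≤1+r[X-f] X f) (≤∧≢⇒< (r-mono M (X - f) X (p─q⊆p X ⁅ f ⁆)) r≢)

  suc-ν[X-f]≡ν[X] : ∀ {X f} → f ∈ X → r M (X - f) ≡ r M X → suc (ν (X - f)) ≡ ν X
  suc-ν[X-f]≡ν[X] {X} {f} f∈X r≡ = sym (r+m≡∣∣⇒ν≡m (begin
    r M X + suc (ν (X - f))       ≡⟨ cong (_+ suc (ν (X - f))) r≡ ⟨
    r M (X - f) + suc (ν (X - f)) ≡⟨ +-suc (r M (X - f)) (ν (X - f)) ⟩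
    suc (r M (X - f) + ν (X - f)) ≡⟨ cong suc (r+ν≡∣∣ (X - f)) ⟩
    suc ∣ X - f ∣                 ≡⟨ x∈p⇒suc∣p-x∣≡∣p∣ f∈X ⟩
    ∣ X ∣                         ∎))
    where open ≡-Reasoning

  FoldCircuit⇒ν≡ : ∀ {k B} → FoldCircuit M k B → ν B ≡ k
  FoldCircuit⇒ν≡ (_ , r+k≡∣B∣) = r+m≡∣∣⇒ν≡m r+k≡∣B∣

  Cyclic∧ν≡⇒FoldCircuit : ∀ {k B} → Cyclic M B → ν B ≡ k → FoldCircuit M k B
  Cyclic∧ν≡⇒FoldCircuit {B = B} cyclic refl = cyclic , r+ν≡∣∣ B

  cyclic-⊆⇒r[U-e]≡r[U] : ∀ {B U e} → Cyclic M B → B ⊆ U → e ∈ B → r M (U - e) ≡ r M U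
  cyclic-⊆⇒r[U-e]≡r[U] {B} {U} {e} cyclic B⊆U e∈B =
    ≤-antisym (r-mono M (U - e) U (p─q⊆p U ⁅ e ⁆)) (+-cancelʳ-≤ (r M B) (r M U) (r M (U - e)) (begin
      r M U + r M B                         ≡⟨ cong (r M U +_) (cyclic e e∈B) ⟨
      r M U + r M (B - e)                   ≤⟨ +-mono-≤ (r-mono M U _ U⊆) (r-mono M (B - e) _ B-e⊆) ⟩
      r M ((U - e) ∪ B) + r M ((U - e) ∩ B) ≤⟨ r-submod M (U - e) B ⟩
      r M (U - e) + r M B                   ∎))
    where
    open ≤-Reasoning
    U⊆ : U ⊆ (U - e) ∪ B
    U⊆ {x} x∈U with x ∈? B
    ... | yes x∈B = q⊆p∪q (U - e) B x∈B
    ... | no  x∉B = p⊆p∪q B (x∈p∧x≢y⇒x∈p-y x∈U λ { refl → x∉B e∈B })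
    B-e⊆ : B - e ⊆ (U - e) ∩ B
    B-e⊆ {x} x∈B-e = x∈p∩q⁺ (x∈p∧x∉q⇒x∈p─q (B⊆U x∈B) (x∈p─q⇒x∉q B ⁅ e ⁆ x∈B-e) , x∈B)
      where
      x∈B : x ∈ B
      x∈B = p─q⊆p B ⁅ e ⁆ x∈B-e

  cyclic-∪ : ∀ {B B′} → Cyclic M B → Cyclic M B′ → Cyclic M (B ∪ B′)
  cyclic-∪ {B} {B′} cyclic cyclic′ e e∈B∪B′ with x∈p∪q⁻ B B′ e∈B∪B′
  ... | inj₁ e∈B  = cyclic-⊆⇒r[U-e]≡r[U] cyclic (p⊆p∪q B′) e∈B
  ... | inj₂ e∈B′ = cyclic-⊆⇒r[U-e]≡r[U] cyclic′ (q⊆p∪q B B′) e∈B′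

  cyclic∧x∉C⇒ν[C]<ν[U] : ∀ {U C x} → Cyclic M U → C ⊆ U → x ∈ U → x ∉ C → ν C < ν U
  cyclic∧x∉C⇒ν[C]<ν[U] {U} {C} {x} cyclic C⊆U x∈U x∉C = begin-strict
    ν C       ≤⟨ ν-mono (p⊆q∧x∉p⇒p⊆q-x C⊆U x∉C) ⟩
    ν (U - x) <⟨ ≤-reflexive (suc-ν[X-f]≡ν[X] x∈U (cyclic x x∈U)) ⟩
    ν U       ∎
    where open ≤-Reasoning

  cyclic∧ν[U]≤ν[C]⇒C≡U : ∀ {U C} → Cyclic M U → C ⊆ U → ν U ≤ ν C → C ≡ U
  cyclic∧ν[U]≤ν[C]⇒C≡U {U} {C} cyclic C⊆U νU≤νC = ⊆-antisym C⊆U U⊆C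
    where
    U⊆C : U ⊆ C
    U⊆C {x} x∈U with x ∈? C
    ... | yes x∈C = x∈C
    ... | no  x∉C = contradiction (cyclic∧x∉C⇒ν[C]<ν[U] cyclic C⊆U x∈U x∉C) (≤⇒≯ νU≤νC)

  cyclic-⊆-ν≥-unique : ∀ {X B B′} → Cyclic M B → Cyclic M B′ → B ⊆ X → B′ ⊆ X →
                       ν X ≤ ν B → ν X ≤ ν B′ → B ≡ B′
  cyclic-⊆-ν≥-unique {X} {B} {B′} cyclic cyclic′ B⊆X B′⊆X νX≤νB νX≤νB′ =
    trans (cyclic∧ν[U]≤ν[C]⇒C≡U cyclic∪ (p⊆p∪q B′) (≤-trans ν∪≤νX νX≤νB))
          (sym (cyclic∧ν[U]≤ν[C]⇒C≡U cyclic∪ (q⊆p∪q B B′) (≤-trans ν∪≤νX νX≤νB′)))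
    where
    cyclic∪ : Cyclic M (B ∪ B′)
    cyclic∪ = cyclic-∪ cyclic cyclic′
    ν∪≤νX : ν (B ∪ B′) ≤ ν X
    ν∪≤νX = ν-mono λ x∈B∪B′ → [ B⊆X , B′⊆X ]′ (x∈p∪q⁻ B B′ x∈B∪B′)

  ν<⇒Nonempty[Y─X] : ∀ {X Y} → ν X < ν Y → Nonempty (Y ─ X)
  ν<⇒Nonempty[Y─X] {X} {Y} νX<νY with nonempty? (Y ─ X)
  ... | yes nonempty = nonempty
  ... | no  empty    = contradiction (ν-mono (Empty[p─q]⇒p⊆q Y X empty)) (<⇒≱ νX<νY)

  cyclic-core : ∀ X → Σ[ C ∈ Subset n ] (C ⊆ X × Cyclic M C × ν C ≡ ν X)
  cyclic-core X = go X (<-wellFounded ∣ X ∣)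
    where
    go : ∀ X → Acc _<_ ∣ X ∣ → Σ[ C ∈ Subset n ] (C ⊆ X × Cyclic M C × ν C ≡ ν X)
    go X (acc rec) with any? (λ f → f ∈? X ×-dec ¬? (r M (X - f) ≟ r M X))
    ... | yes (f , f∈X , r≢) =
      let C , C⊆X-f , cyclic , νC≡ = go (X - f) (rec (x∈p⇒∣p-x∣<∣p∣ f∈X))
      in  C , ⊆-trans C⊆X-f (p─q⊆p X ⁅ f ⁆) , cyclic , trans νC≡ (ν[X-f]≡ν[X] f∈X r≢)
    ... | no  no-coloop = X , ⊆-refl , cyclic , refl
      where
      cyclic : Cyclic M X
      cyclic f f∈X = decidable-stable (r M (X - f) ≟ r M X) λ r≢ → no-coloop (f , f∈X , r≢)

  foldr-∩-⊆ : ∀ (D : Subset n) Bs → foldr _∩_ D Bs ⊆ D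
  foldr-∩-⊆ D []       = id
  foldr-∩-⊆ D (B ∷ Bs) = foldr-∩-⊆ D Bs ∘ p∩q⊆q B (foldr _∩_ D Bs)

  foldr-∩-⊆-∈ : ∀ {D B : Subset n} {Bs} → B ∈ₗ Bs → foldr _∩_ D Bs ⊆ B
  foldr-∩-⊆-∈ {D} {B} {B ∷ Bs} (here refl) = p∩q⊆p B (foldr _∩_ D Bs)
  foldr-∩-⊆-∈ {D} {_} {B′ ∷ Bs} (there B∈) = foldr-∩-⊆-∈ B∈ ∘ p∩q⊆q B′ (foldr _∩_ D Bs)

  ν≤ν[foldr-∩]+length : ∀ (D : Subset n) Bs → (∀ {B} → B ∈ₗ Bs → B ⊆ D × ν D ≤ suc (ν B)) →
                        ν D ≤ ν (foldr _∩_ D Bs) + length Bs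
  ν≤ν[foldr-∩]+length D []       _      = ≤-reflexive (sym (+-identityʳ (ν D)))
  ν≤ν[foldr-∩]+length D (B ∷ Bs) member = begin
    ν D                              ≤⟨ ν≤ν[foldr-∩]+length D Bs (member ∘ there) ⟩
    ν X + length Bs                  ≤⟨ +-monoˡ-≤ (length Bs) νX≤1+ν[B∩X] ⟩
    suc (ν (B ∩ X)) + length Bs      ≡⟨ +-suc (ν (B ∩ X)) (length Bs) ⟨
    ν (B ∩ X) + length (B ∷ Bs)      ∎
    where
    open ≤-Reasoning
    X : Subset n
    X = foldr _∩_ D Bs
    B⊆D : B ⊆ D
    B⊆D = proj₁ (member (here refl))
    B∪X⊆D : B ∪ X ⊆ D
    B∪X⊆D x∈B∪X = [ B⊆D , foldr-∩-⊆ D Bs ]′ (x∈p∪q⁻ B X x∈B∪X)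
    νX≤1+ν[B∩X] : ν X ≤ suc (ν (B ∩ X))
    νX≤1+ν[B∩X] = +-cancelˡ-≤ (ν B) (ν X) (suc (ν (B ∩ X))) (begin
      ν B + ν X              ≤⟨ ν-supermodular B X ⟩
      ν (B ∪ X) + ν (B ∩ X)  ≤⟨ +-monoˡ-≤ (ν (B ∩ X)) (ν-mono B∪X⊆D) ⟩
      ν D + ν (B ∩ X)        ≤⟨ +-monoˡ-≤ (ν (B ∩ X)) (proj₂ (member (here refl))) ⟩
      suc (ν B) + ν (B ∩ X)  ≡⟨ +-suc (ν B) (ν (B ∩ X)) ⟨
      ν B + suc (ν (B ∩ X))  ∎)

module FoldCircuitComplements {n} (M : Matroid n) {k D} (D-fold : FoldCircuit M (suc k) D) where
  open Nullity M

  νD≡1+k : ν D ≡ suc k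
  νD≡1+k = FoldCircuit⇒ν≡ D-fold

  ν[D-e]≡k : ∀ {e} → e ∈ D → ν (D - e) ≡ k
  ν[D-e]≡k e∈D = suc-injective (trans (suc-ν[X-f]≡ν[X] e∈D (proj₁ D-fold _ e∈D)) νD≡1+k)

  D─B-nonempty : ∀ {B} → FoldCircuit M k B → Nonempty (D ─ B)
  D─B-nonempty B-fold =
    ν<⇒Nonempty[Y─X] (≤-reflexive (trans (cong suc (FoldCircuit⇒ν≡ B-fold)) (sym νD≡1+k)))

  D─B-disjoint : ∀ {B B′} → FoldCircuit M k B × B ⊆ D → FoldCircuit M k B′ × B′ ⊆ D →
                 B ≢ B′ → Empty ((D ─ B) ∩ (D ─ B′))
  D─B-disjoint {B} {B′} (B-fold , B⊆D) (B′-fold , B′⊆D) B≢B′ (e , e∈∩) =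
    B≢B′ (cyclic-⊆-ν≥-unique (proj₁ B-fold) (proj₁ B′-fold)
            (p⊆q∧x∉p⇒p⊆q-x B⊆D (x∈p─q⇒x∉q D B e∈D─B))
            (p⊆q∧x∉p⇒p⊆q-x B′⊆D (x∈p─q⇒x∉q D B′ e∈D─B′))
            (≤-reflexive (trans (ν[D-e]≡k e∈D) (sym (FoldCircuit⇒ν≡ B-fold))))
            (≤-reflexive (trans (ν[D-e]≡k e∈D) (sym (FoldCircuit⇒ν≡ B′-fold)))))
    where
    e∈D─B : e ∈ D ─ B
    e∈D─B = proj₁ (x∈p∩q⁻ (D ─ B) (D ─ B′) e∈∩)
    e∈D─B′ : e ∈ D ─ B′
    e∈D─B′ = proj₂ (x∈p∩q⁻ (D ─ B) (D ─ B′) e∈∩)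
    e∈D : e ∈ D
    e∈D = p─q⊆p D B e∈D─B

  D─B-cover : ∀ {e} → e ∈ D → Σ[ B ∈ Subset n ] ((FoldCircuit M k B × B ⊆ D) × e ∈ D ─ B)
  D─B-cover {e} e∈D =
    let C , C⊆D-e , cyclic , νC≡ = cyclic-core (D - e)
    in  C , (Cyclic∧ν≡⇒FoldCircuit cyclic (trans νC≡ (ν[D-e]≡k e∈D)) , p─q⊆p D ⁅ e ⁆ ∘ C⊆D-e)
          , x∈p∧x∉q⇒x∈p─q e∈D λ e∈C → x∈p─q⇒x∉q D ⁅ e ⁆ (C⊆D-e e∈C) (x∈⁅x⁆ e)

  1+k≤length : ∀ Bs → (∀ {B} → B ∈ₗ Bs → FoldCircuit M k B × B ⊆ D) →
               (∀ e → e ∈ D → ∃ λ B → B ∈ₗ Bs × e ∈ D ─ B) → suc k ≤ length Bs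
  1+k≤length Bs member cover = begin
    suc k                    ≡⟨ νD≡1+k ⟨
    ν D                      ≤⟨ ν≤ν[foldr-∩]+length D Bs bound ⟩
    ν X + length Bs          ≡⟨ cong (_+ length Bs) νX≡0 ⟩
    length Bs                ∎
    where
    open ≤-Reasoning
    X : Subset n
    X = foldr _∩_ D Bs
    bound : ∀ {B} → B ∈ₗ Bs → B ⊆ D × ν D ≤ suc (ν B)
    bound B∈ = let B-fold , B⊆D = member B∈
               in  B⊆D , ≤-reflexive (trans νD≡1+k (cong suc (sym (FoldCircuit⇒ν≡ B-fold))))
    X-empty : Empty X
    X-empty (x , x∈X) =
      let B , B∈ , x∈D─B = cover x (foldr-∩-⊆ D Bs x∈X)
      in  x∈p─q⇒x∉q D B x∈D─B (foldr-∩-⊆-∈ B∈ x∈X)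
    νX≡0 : ν X ≡ 0
    νX≡0 = n≤0⇒n≡0 (≤-trans (ν≤∣∣ X) (≤-reflexive (trans (cong ∣_∣ (Empty-unique X-empty)) (∣⊥∣≡0 n))))

-- Distinctness of Bs is not needed: repeated entries only make the list longer.
mainTheorem1 : ∀ {n} (M : Matroid n) (k : ℕ) (D : Subset n) →
    FoldCircuit M (suc k) D →
    (Bs : List (Subset n)) → Unique Bs →
    (∀ B → (B ∈ₗ Bs) ⇔ (FoldCircuit M k B × B ⊆ D)) →
    ((∀ B → B ∈ₗ Bs → Nonempty (D ─ B))
      × (∀ B B′ → B ∈ₗ Bs → B′ ∈ₗ Bs → B ≢ B′ → Empty ((D ─ B) ∩ (D ─ B′)))
      × (∀ e → e ∈ D → ∃ λ B → B ∈ₗ Bs × e ∈ (D ─ B)))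
    × suc k ≤ length Bs
mainTheorem1 M k D D-fold Bs _ Bs-spec = (nonempty , disjoint , cover) , 1+k≤length Bs member cover
  where
  open FoldCircuitComplements M D-fold
  member : ∀ {B} → B ∈ₗ Bs → FoldCircuit M k B × B ⊆ D
  member {B} = Equivalence.to (Bs-spec B)
  nonempty : ∀ B → B ∈ₗ Bs → Nonempty (D ─ B)
  nonempty B B∈ = D─B-nonempty (proj₁ (member B∈))
  disjoint : ∀ B B′ → B ∈ₗ Bs → B′ ∈ₗ Bs → B ≢ B′ → Empty ((D ─ B) ∩ (D ─ B′))
  disjoint B B′ B∈ B′∈ = D─B-disjoint (member B∈) (member B′∈)
  cover : ∀ e → e ∈ D → ∃ λ B → B ∈ₗ Bs × e ∈ (D ─ B)
  cover e e∈D = let B , B-spec , e∈D─B = D─B-cover e∈D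
                in  B , Equivalence.from (Bs-spec B) B-spec , e∈D─B
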